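{- (a) Let $n\ge 1$ and let $X_1,\ldots,X_k$ be pairwise disjoint finite sets with $|X_i|\le n$ for $i=1,\ldots,k$, and let $X=\bigcup_{i=1}^k X_i$. If $\mathcal F\subseteq 2^X$ satisfies $|\mathcal F|>2^{|X|-1}$, then there is a subfamily $\mathcal G\subseteq\mathcal F$ with $|\mathcal G|\le\lceil\log_2 n\rceil+1$ such that for every $i=1,\ldots,k$, every pair of distinct elements of $X_i$ is separated by some member of $\mathcal G$. (b) The bound is tight: for every integer $n\ge 2$ there exist $k$, pairwise disjoint sets $X_1,\ldots,X_k$ with $|X_i|\le n$, and a family $\mathcal F\subseteq 2^X$ (where $X=\bigcup_i X_i$) with $|\mathcal F|>2^{|X|-1}$, such that no subfamily of $\mathcal F$ of cardinality at most $\lceil\log_2 n\rceil$ separates every pair of distinct elements of $X_i$ for all $i=1,\ldots,k$ simultaneously.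
   Context: A set $F$ separates two elements $x,y$ if it contains exactly one of them; a family separates a pair if at least one of its members separates it. -}

module Defs where

open import Data.Nat using (ℕ; _≤_; _<_; _*_; _+_; _^_)
open import Data.Fin using (Fin; _≟_)
open import Data.Fin.Subset using (Subset; _∈_; _∉_; ∣_∣)
open import Data.Vec using (tabulate)
open import Data.Bool using (if_then_else_)
open import Data.List using (List; length)
open import Data.List.Relation.Unary.All using (All)
open import Data.List.Relation.Unary.Any using (Any)
open import Data.List.Relation.Unary.Unique.Propositional using (Unique)
import Data.List.Membership.Propositional as LM
open import Data.Product using (_×_)
open import Data.Sum using (_⊎_)
open import Relation.Binary.PropositionalEquality using (_≡_; _≢_)
open import Relation.Nullary.Decidable using (does)
open import Data.Fin.Subset using (Side; inside; outside)

-- The ground set X is Fin m. A partition of X into pairwise disjoint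
-- (possibly empty) parts X_1,…,X_k is given by  part : Fin m → Fin k,
-- with X_i = { x | part x ≡ i }.

block : ∀ {m k} → (Fin m → Fin k) → Fin k → Subset m
block part i = tabulate (λ x → if does (part x ≟ i) then inside else outside)

BlocksBounded : ∀ {m k} → (Fin m → Fin k) → ℕ → Set
BlocksBounded {k = k} part n = (i : Fin k) → ∣ block part i ∣ ≤ n

Separates : ∀ {m} → Subset m → Fin m → Fin m → Set
Separates F x y = (x ∈ F × y ∉ F) ⊎ (y ∈ F × x ∉ F)

SeparatesBlocks : ∀ {m k} → (Fin m → Fin k) → List (Subset m) → Set
SeparatesBlocks {m} part G =
  (x y : Fin m) → part x ≡ part y → x ≢ y → Any (λ S → Separates S x y) G

SubFamily : ∀ {m} → List (Subset m) → List (Subset m) → Set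
SubFamily G F = All (LM._∈ F) G

-- a family F ⊆ 2^X (X = Fin m), given as a duplicate-free list, with
-- |F| > 2^(|X|-1), written as 2·|F| > 2^|X|
LargeFamily : ∀ m → List (Subset m) → Set
LargeFamily m F = Unique F × 2 ^ m < 2 * length F

module Submission where

-- (a) Let X = Fin m be split into blocks of size ≤ n, let F ⊆ 2^X have more
-- than 2^(m-1) members and put t = ⌈log₂ n⌉.  Code each point by t bits,
-- injectively within its block (the binary expansion of its rank in the
-- block), and for α ∈ 𝔹^t let φ α = {x | α · code x = 1}.  Averaging over all
-- translations A, some A makes D = {α | A ⊕ φ α ∈ F} fill more than half of
-- 𝔹^t.  Such a D contains a frame: a point α₀ with t directions β_i such that
-- α₀ ⊕ β_i ∈ D and the functionals β_i · _ jointly distinguish the points of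
-- 𝔹^t (induction on t, passing to the denser half of the cube).  The t + 1 sets
-- A ⊕ φ α₀ and A ⊕ φ (α₀ ⊕ β_i) separate every block: two points of a block
-- have different codes, hence some β_i flips exactly one of them.
--
-- (b) Take c = 2^n - 2 blocks of size n and let F consist of the sets constant
-- on at least one block.  Exactly c^c sets are constant on no block, and the
-- Bernoulli bound 2 c^c < (c + 2)^c = 2^|X| makes F large.  In a subfamily of
-- at most ⌈log₂ n⌉ members the first is constant on some block, and by the
-- pigeonhole principle the fewer than log₂ n others leave two points of that
-- block unseparated.

open import Defs
open import Algebra.Bundles using (CommutativeRing)
open import Data.Bool.Base using (Bool; true; false; not; _∧_; _∨_; _xor_; if_then_else_; T)
import Data.Bool.Properties as Bool
open import Data.Bool.Properties
  using (xor-comm; xor-assoc; xor-same; xor-identityʳ; not-injective; ∧-distribʳ-xor; xor-∧-commutativeRing; T-∨)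
open import Data.Empty using (⊥-elim)
open import Data.Fin as Fin using (Fin; zero; suc; fromℕ<; remQuot; combine; _↑ˡ_; _↑ʳ_)
open import Data.Fin.Properties
  using (fromℕ<-injective; combine-remQuot; pigeonhole; combine-injectiveˡ; combine-injectiveʳ;
         splitAt-↑ˡ; splitAt-↑ʳ; ↑ˡ-injective; ↑ʳ-injective)
  renaming (<⇒≢ to <⇒≢ᶠ)
open import Data.Fin.Subset using (Subset; ∣_∣; inside; outside; _∉_)
open import Data.List.Base as List using (List; []; _∷_; length; map; filterᵇ)
open import Data.List.Membership.Propositional using (_∈_)
open import Data.List.Membership.Propositional.Properties using (∈-map⁻; ∈-filter⁻)
open import Data.List.Properties using (length-map; map-++; map-∘)
open import Data.List.Relation.Unary.All as All using (All; []; _∷_)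
import Data.List.Relation.Unary.All.Properties as All
open import Data.List.Relation.Unary.Any as Any using (Any; here; there)
import Data.List.Relation.Unary.Any.Properties as Any
open import Data.List.Relation.Unary.Unique.Propositional using (Unique; []; _∷_)
import Data.List.Relation.Unary.Unique.Propositional.Properties as Unique
open import Data.Nat.Base
open import Data.Nat.Induction using (<-rec)
open import Data.Nat.ListAction using (sum)
open import Data.Nat.ListAction.Properties using (sum-++)
open import Data.Nat.Logarithm using (⌈log₂_⌉; ⌈log₂⌉-mono-≤; ⌈log₂2^n⌉≡n; ⌈log₂⌈n/2⌉⌉≡⌈log₂n⌉∸1)
open import Data.Nat.Properties
open import Data.Nat.Tactic.RingSolver using (solve-∀)
open import Data.Product.Base using (∃; ∃₂; ∃-syntax; Σ; _×_; _,_; proj₁; proj₂; uncurry)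
open import Data.Sum.Base using (_⊎_; inj₁; inj₂; [_,_]′)
open import Data.Vec.Base using (Vec; []; _∷_; _++_; lookup; tabulate; zipWith; replicate; take; drop)
open import Data.Vec.Properties
  using (≡-dec; ∷-injectiveˡ; ∷-injectiveʳ; lookup-zipWith; lookup∘tabulate; lookup⇒[]=; []=⇒lookup;
         tabulate-cong; lookup-replicate; take++drop≡id; ++-injective; lookup-++ˡ; lookup-++ʳ)
open import Function.Base using (_∘_)
open import Function.Bundles using (Equivalence)
open import Relation.Binary.Definitions using (DecidableEquality)
open import Relation.Binary.PropositionalEquality
open import Relation.Nullary using (yes; no; does; ¬_; T?)
open import Relation.Nullary.Decidable using (dec-true)
open import Algebra.Properties.CommutativeSemigroup +-commutativeSemigroup using (interchange)
open import Algebra.Properties.CommutativeSemigroup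
  (CommutativeRing.+-commutativeSemigroup xor-∧-commutativeRing) using ()
  renaming (interchange to xor-interchange)

sumCube : ∀ m → (Vec Bool m → ℕ) → ℕ
sumCube zero    h = h []
sumCube (suc m) h = sumCube m (λ v → h (true ∷ v)) + sumCube m (λ v → h (false ∷ v))

_⊕_ : ∀ {m} → Vec Bool m → Vec Bool m → Vec Bool m
_⊕_ = zipWith _xor_

sumCube-cong : ∀ m {f g : Vec Bool m → ℕ} → (∀ v → f v ≡ g v) → sumCube m f ≡ sumCube m g
sumCube-cong zero    f≡g = f≡g []
sumCube-cong (suc m) f≡g =
  cong₂ _+_ (sumCube-cong m (λ v → f≡g (true ∷ v))) (sumCube-cong m (λ v → f≡g (false ∷ v)))

sumCube-+ : ∀ m (f g : Vec Bool m → ℕ) →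
            sumCube m (λ v → f v + g v) ≡ sumCube m f + sumCube m g
sumCube-+ zero    f g = refl
sumCube-+ (suc m) f g =
  trans (cong₂ _+_ (sumCube-+ m (λ v → f (true ∷ v)) (λ v → g (true ∷ v)))
                   (sumCube-+ m (λ v → f (false ∷ v)) (λ v → g (false ∷ v))))
        (interchange (sumCube m (λ v → f (true ∷ v))) (sumCube m (λ v → g (true ∷ v)))
                     (sumCube m (λ v → f (false ∷ v))) (sumCube m (λ v → g (false ∷ v))))

sumCube-*ˡ : ∀ m c (f : Vec Bool m → ℕ) → sumCube m (λ v → c * f v) ≡ c * sumCube m f
sumCube-*ˡ zero    c f = refl
sumCube-*ˡ (suc m) c f =
  trans (cong₂ _+_ (sumCube-*ˡ m c _) (sumCube-*ˡ m c _)) (sym (*-distribˡ-+ c _ _))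

*-2^suc : ∀ c m → c * 2 ^ suc m ≡ c * 2 ^ m + c * 2 ^ m
*-2^suc c m = trans (cong (λ z → c * (2 ^ m + z)) (+-identityʳ _)) (*-distribˡ-+ c _ _)

sumCube-const : ∀ m c → sumCube m (λ _ → c) ≡ c * 2 ^ m
sumCube-const zero    c = sym (*-identityʳ c)
sumCube-const (suc m) c =
  trans (cong₂ _+_ (sumCube-const m c) (sumCube-const m c)) (sym (*-2^suc c m))

sumCube-mono : ∀ m {f g : Vec Bool m → ℕ} → (∀ v → f v ≤ g v) → sumCube m f ≤ sumCube m g
sumCube-mono zero    f≤g = f≤g []
sumCube-mono (suc m) f≤g =
  +-mono-≤ (sumCube-mono m (λ v → f≤g (true ∷ v))) (sumCube-mono m (λ v → f≤g (false ∷ v)))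

sumCube-translate : ∀ m (h : Vec Bool m → ℕ) T → sumCube m (λ v → h (v ⊕ T)) ≡ sumCube m h
sumCube-translate zero    h []          = refl
sumCube-translate (suc m) h (false ∷ T) =
  cong₂ _+_ (sumCube-translate m (λ v → h (true ∷ v)) T)
            (sumCube-translate m (λ v → h (false ∷ v)) T)
sumCube-translate (suc m) h (true ∷ T)  =
  trans (cong₂ _+_ (sumCube-translate m (λ v → h (false ∷ v)) T)
                   (sumCube-translate m (λ v → h (true ∷ v)) T))
        (+-comm (sumCube m (λ v → h (false ∷ v))) (sumCube m (λ v → h (true ∷ v))))

sumCube-swap : ∀ m t (h : Vec Bool m → Vec Bool t → ℕ) →
               sumCube m (λ v → sumCube t (h v)) ≡ sumCube t (λ w → sumCube m (λ v → h v w))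
sumCube-swap zero    t h = refl
sumCube-swap (suc m) t h =
  trans (cong₂ _+_ (sumCube-swap m t (λ v → h (true ∷ v))) (sumCube-swap m t (λ v → h (false ∷ v))))
        (sym (sumCube-+ t _ _))

sumCube-++ : ∀ a r (h : Vec Bool (a + r) → ℕ) →
             sumCube (a + r) h ≡ sumCube a (λ u → sumCube r (λ v → h (u ++ v)))
sumCube-++ zero    r h = refl
sumCube-++ (suc a) r h =
  cong₂ _+_ (sumCube-++ a r (λ v → h (true ∷ v))) (sumCube-++ a r (λ v → h (false ∷ v)))

half-below : ∀ {a x y} → a + a < x + y → a < x ⊎ a < y
half-below {a} {x} {y} a+a<x+y with a <? x
... | yes a<x = inj₁ a<x
... | no  a≮x = inj₂ (+-cancelˡ-< a a y (<-≤-trans a+a<x+y (+-monoˡ-≤ y (≮⇒≥ a≮x))))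

sumCube-average : ∀ m (h : Vec Bool m → ℕ) B → B * 2 ^ m < sumCube m h → ∃ λ v → B < h v
sumCube-average zero    h B B<h = [] , subst (_< h []) (*-identityʳ B) B<h
sumCube-average (suc m) h B B2^m<h
  with half-below (subst (_< sumCube (suc m) h) (*-2^suc B m) B2^m<h)
... | inj₁ lt = let v , p = sumCube-average m (λ v → h (true ∷ v)) B lt in true ∷ v , p
... | inj₂ lt = let v , p = sumCube-average m (λ v → h (false ∷ v)) B lt in false ∷ v , p

_·_ : ∀ {t} → Vec Bool t → Vec Bool t → Bool
[]      · []      = false
(a ∷ u) · (b ∷ v) = (a ∧ b) xor (u · v)

·-linearˡ : ∀ {t} (α β w : Vec Bool t) → (α ⊕ β) · w ≡ (α · w) xor (β · w)
·-linearˡ []      []      []      = refl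
·-linearˡ (a ∷ α) (b ∷ β) (c ∷ w) = begin
  ((a xor b) ∧ c) xor ((α ⊕ β) · w)               ≡⟨ cong₂ _xor_ (∧-distribʳ-xor c a b) (·-linearˡ α β w) ⟩
  ((a ∧ c) xor (b ∧ c)) xor ((α · w) xor (β · w)) ≡⟨ xor-interchange (a ∧ c) (b ∧ c) (α · w) (β · w) ⟩
  ((a ∧ c) xor (α · w)) xor ((b ∧ c) xor (β · w)) ∎
  where open ≡-Reasoning

xor-cancelˡ : ∀ a {b c} → a xor b ≡ a xor c → b ≡ c
xor-cancelˡ true  eq = not-injective eq
xor-cancelˡ false eq = eq

xor-cancelʳ : ∀ a {b c} → b xor a ≡ c xor a → b ≡ c
xor-cancelʳ a {b} {c} eq = xor-cancelˡ a (trans (xor-comm a b) (trans eq (xor-comm c a)))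

⊕-cancelˡ : ∀ {t} (α γ : Vec Bool t) → α ⊕ (α ⊕ γ) ≡ γ
⊕-cancelˡ []      []      = refl
⊕-cancelˡ (a ∷ α) (c ∷ γ) =
  cong₂ _∷_ (trans (sym (xor-assoc a a c)) (cong (_xor c) (xor-same a))) (⊕-cancelˡ α γ)

_≟ᵛ_ : ∀ {m} → DecidableEquality (Vec Bool m)
_≟ᵛ_ = ≡-dec Bool._≟_

Distinguishing : ∀ {t} → List (Vec Bool t) → Set
Distinguishing {t} βs = (v w : Vec Bool t) → v ≢ w → Any (λ β → β · v ≢ β · w) βs

record Frame {t} (D : Vec Bool t → Set) : Set where
  field
    base           : Vec Bool t
    dirs           : List (Vec Bool t)
    base∈D         : D base
    dirs∈D         : All (λ β → D (base ⊕ β)) dirs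
    #dirs          : length dirs ≡ t
    distinguishing : Distinguishing dirs

-- A frame of the slice {α | b ∷ α ∈ D} plus one point of the opposite slice
-- yields a frame of D: the new direction jumps between the slices.
extend : ∀ {t} {D : Vec Bool (suc t) → Set} (b : Bool) → Frame (λ α → D (b ∷ α)) →
         (γ : Vec Bool t) → D (not b ∷ γ) → Frame D
extend {t} {D} b fr γ γ∈D = record
  { base           = b ∷ base
  ; dirs           = new ∷ map (false ∷_) dirs
  ; base∈D         = base∈D
  ; dirs∈D         = subst D jump γ∈D ∷ All.map⁺ (All.map (subst D stay) dirs∈D)
  ; #dirs          = cong suc (trans (length-map (false ∷_) dirs) #dirs)
  ; distinguishing = distinguish
  }
  where
  open Frame fr
  new : Vec Bool (suc t)
  new = true ∷ (base ⊕ γ)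
  jump : not b ∷ γ ≡ (b ∷ base) ⊕ new
  jump = cong₂ _∷_ (sym (xor-comm b true)) (sym (⊕-cancelˡ base γ))
  stay : ∀ {β} → b ∷ (base ⊕ β) ≡ (b ∷ base) ⊕ (false ∷ β)
  stay = cong (_∷ _) (sym (xor-identityʳ b))
  distinguish : Distinguishing (new ∷ map (false ∷_) dirs)
  distinguish (a ∷ v) (c ∷ w) av≢cw with v ≟ᵛ w
  ... | yes refl = here (λ eq → av≢cw (cong (_∷ v) (xor-cancelʳ ((base ⊕ γ) · v) eq)))
  ... | no  v≢w  = there (Any.map⁺ (distinguishing v w v≢w))

dense-split : ∀ {N x y} → x ≤ N → y ≤ N → N < x + y → (N < 2 * x × 0 < y) ⊎ (N < 2 * y × 0 < x)
dense-split {N} {x} {y} x≤N y≤N N<x+y with N <? 2 * x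
... | yes N<2x = inj₁ (N<2x , +-cancelˡ-< x 0 y (subst (_< x + y) (sym (+-identityʳ x)) (≤-<-trans x≤N N<x+y)))
... | no  N≮2x = inj₂ (N<2y , +-cancelʳ-< y 0 x (≤-<-trans y≤N N<x+y))
  where
  N<2y : N < 2 * y
  N<2y = +-cancelˡ-< N N (2 * y) (begin-strict
    N + N         ≡⟨ cong (N +_) (sym (+-identityʳ N)) ⟩
    2 * N         <⟨ *-monoʳ-< 2 N<x+y ⟩
    2 * (x + y)   ≡⟨ *-distribˡ-+ 2 x y ⟩
    2 * x + 2 * y ≤⟨ +-monoˡ-≤ (2 * y) (≮⇒≥ N≮2x) ⟩
    N + 2 * y     ∎)
    where open ≤-Reasoning

slice≤2^t : ∀ {t} (g : Vec Bool (suc t) → ℕ) → (∀ α → g α ≤ 1) → ∀ b → sumCube t (λ v → g (b ∷ v)) ≤ 2 ^ t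
slice≤2^t {t} g g≤1 b = ≤-trans (sumCube-mono t (λ v → g≤1 (b ∷ v)))
                               (≤-reflexive (trans (sumCube-const t 1) (*-identityˡ _)))

frame : ∀ t (g : Vec Bool t → ℕ) → (∀ α → g α ≤ 1) → 2 ^ t < 2 * sumCube t g →
        Frame (λ α → 0 < g α)
frame zero    g _   dense = record
  { base = [] ; dirs = [] ; base∈D = *-cancelˡ-< 2 0 (g []) (<-trans z<s dense) ; dirs∈D = []
  ; #dirs = refl ; distinguishing = λ { [] [] []≢[] → ⊥-elim ([]≢[] refl) } }
frame (suc t) g g≤1 dense
  with dense-split (slice≤2^t g g≤1 true) (slice≤2^t g g≤1 false) (*-cancelˡ-< 2 _ _ dense)
... | inj₁ (denseT , F≢∅) =
  let γ , γ∈D = sumCube-average t (λ v → g (false ∷ v)) 0 F≢∅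
  in extend true (frame t (λ v → g (true ∷ v)) (λ v → g≤1 (true ∷ v)) denseT) γ γ∈D
... | inj₂ (denseF , T≢∅) =
  let γ , γ∈D = sumCube-average t (λ v → g (true ∷ v)) 0 T≢∅
  in extend false (frame t (λ v → g (false ∷ v)) (λ v → g≤1 (false ∷ v)) denseF) γ γ∈D

𝟙 : Bool → ℕ
𝟙 b = if b then 1 else 0

occ : ∀ {m} → Vec Bool m → List (Vec Bool m) → ℕ
occ S []      = 0
occ S (A ∷ F) = 𝟙 (does (S ≟ᵛ A)) + occ S F

sumCube-point : ∀ m (A : Vec Bool m) → sumCube m (λ S → 𝟙 (does (S ≟ᵛ A))) ≡ 1
sumCube-point zero    []          = refl
sumCube-point (suc m) (true ∷ A)  = cong₂ _+_ (sumCube-point m A) (sumCube-const m 0)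
sumCube-point (suc m) (false ∷ A) = cong₂ _+_ (sumCube-const m 0) (sumCube-point m A)

sumCube-occ : ∀ m (F : List (Vec Bool m)) → sumCube m (λ S → occ S F) ≡ length F
sumCube-occ m []      = sumCube-const m 0
sumCube-occ m (A ∷ F) =
  trans (sumCube-+ m _ (λ S → occ S F)) (cong₂ _+_ (sumCube-point m A) (sumCube-occ m F))

occ-absent : ∀ {m} (S : Vec Bool m) F → All (S ≢_) F → occ S F ≡ 0
occ-absent S []      []         = refl
occ-absent S (A ∷ F) (S≢A ∷ ps) with S ≟ᵛ A
... | yes S≡A = ⊥-elim (S≢A S≡A)
... | no  _   = occ-absent S F ps

occ-unique : ∀ {m} (S : Vec Bool m) F → Unique F → occ S F ≤ 1
occ-unique S []      _              = z≤n
occ-unique S (A ∷ F) (A∉F ∷ unique) with S ≟ᵛ A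
... | yes refl = ≤-reflexive (cong suc (occ-absent S F A∉F))
... | no  _    = occ-unique S F unique

occ-member : ∀ {m} (S : Vec Bool m) F → 0 < occ S F → S ∈ F
occ-member S (A ∷ F) occ>0 with S ≟ᵛ A
... | yes S≡A = here S≡A
... | no  _   = there (occ-member S F occ>0)

rank : ∀ {m k} → (Fin m → Fin k) → Fin m → ℕ
rank part zero    = 0
rank part (suc x) = 𝟙 (does (part zero Fin.≟ part (suc x))) + rank (part ∘ suc) x

∣block∣-suc : ∀ {m k} (part : Fin (suc m) → Fin k) i →
              ∣ block part i ∣ ≡ 𝟙 (does (part zero Fin.≟ i)) + ∣ block (part ∘ suc) i ∣
∣block∣-suc part i with part zero Fin.≟ i
... | yes _ = refl
... | no  _ = refl

𝟙-≟-refl : ∀ {k} (i : Fin k) → 𝟙 (does (i Fin.≟ i)) ≡ 1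
𝟙-≟-refl i = cong 𝟙 (dec-true (i Fin.≟ i) refl)

rank<∣block∣ : ∀ {m k} (part : Fin m → Fin k) x → rank part x < ∣ block part (part x) ∣
rank<∣block∣ part zero rewrite ∣block∣-suc part (part zero) | 𝟙-≟-refl (part zero) = z<s
rank<∣block∣ part (suc x) = subst (rank part (suc x) <_) (sym (∣block∣-suc part (part (suc x))))
                                  (+-monoʳ-< _ (rank<∣block∣ (part ∘ suc) x))

rank-injective : ∀ {m k} (part : Fin m → Fin k) x y →
                 part x ≡ part y → rank part x ≡ rank part y → x ≡ y
rank-injective part zero    zero    _  _  = refl
rank-injective part zero    (suc y) eq r  rewrite sym eq | 𝟙-≟-refl (part zero) = ⊥-elim (0≢1+n r)
rank-injective part (suc x) zero    eq r  rewrite eq | 𝟙-≟-refl (part zero) = ⊥-elim (0≢1+n (sym r))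
rank-injective part (suc x) (suc y) eq r  = cong suc (rank-injective (part ∘ suc) x y eq
  (+-cancelˡ-≡ (𝟙 (does (part zero Fin.≟ part (suc y)))) _ _
    (trans (cong (λ i → 𝟙 (does (part zero Fin.≟ i)) + rank (part ∘ suc) x) (sym eq)) r)))

bit : Fin 2 → Bool
bit zero    = false
bit (suc _) = true

bit-injective : ∀ {i j} → bit i ≡ bit j → i ≡ j
bit-injective {zero}     {zero}     _ = refl
bit-injective {suc zero} {suc zero} _ = refl

toBits : ∀ t → Fin (2 ^ t) → Vec Bool t
toBits zero    _ = []
toBits (suc t) i = bit (proj₁ (remQuot {2} (2 ^ t) i)) ∷ toBits t (proj₂ (remQuot {2} (2 ^ t) i))

toBits-injective : ∀ t {i j} → toBits t i ≡ toBits t j → i ≡ j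
toBits-injective zero    {zero} {zero} _  = refl
toBits-injective (suc t) {i}    {j}    eq = begin
  i                                  ≡⟨ combine-remQuot {2} (2 ^ t) i ⟨
  uncurry combine (remQuot {2} (2 ^ t) i) ≡⟨ cong (uncurry combine) (cong₂ _,_
                                          (bit-injective (∷-injectiveˡ eq)) (toBits-injective t (∷-injectiveʳ eq))) ⟩
  uncurry combine (remQuot {2} (2 ^ t) j) ≡⟨ combine-remQuot {2} (2 ^ t) j ⟩
  j                                  ∎
  where open ≡-Reasoning

n≤2^⌈log₂n⌉ : ∀ n → n ≤ 2 ^ ⌈log₂ n ⌉
n≤2^⌈log₂n⌉ = <-rec (λ n → n ≤ 2 ^ ⌈log₂ n ⌉) step
  where
  step : ∀ n → (∀ {h} → h < n → h ≤ 2 ^ ⌈log₂ h ⌉) → n ≤ 2 ^ ⌈log₂ n ⌉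
  step zero          _  = z≤n
  step (suc zero)    _  = s≤s z≤n
  step n@(suc (suc k)) ih = begin
    n                             ≡⟨ ⌊n/2⌋+⌈n/2⌉≡n n ⟨
    ⌊ n /2⌋ + ⌈ n /2⌉             ≤⟨ +-monoˡ-≤ _ (⌊n/2⌋≤⌈n/2⌉ n) ⟩
    ⌈ n /2⌉ + ⌈ n /2⌉             ≤⟨ +-mono-≤ half≤ half≤ ⟩
    2 ^ (L ∸ 1) + 2 ^ (L ∸ 1)     ≡⟨ cong (2 ^ (L ∸ 1) +_) (+-identityʳ _) ⟨
    2 ^ suc (L ∸ 1)               ≡⟨ cong (2 ^_) (m+[n∸m]≡n 1≤L) ⟩
    2 ^ L                         ∎
    where
    open ≤-Reasoning
    L : ℕ
    L = ⌈log₂ n ⌉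
    1≤L : 1 ≤ L
    1≤L = ⌈log₂⌉-mono-≤ {2} {n} (s≤s (s≤s z≤n))
    half≤ : ⌈ n /2⌉ ≤ 2 ^ (L ∸ 1)
    half≤ = subst (λ e → ⌈ n /2⌉ ≤ 2 ^ e) (⌈log₂⌈n/2⌉⌉≡⌈log₂n⌉∸1 n) (ih (⌈n/2⌉<n k))

-- Coding the points by ⌈log₂ n⌉ bits, injectively within each block: the
-- binary expansion of the rank of a point inside its block (< n ≤ 2^⌈log₂ n⌉).
block-code : ∀ {m k} (part : Fin m → Fin k) {n} → BlocksBounded part n →
             Σ (Fin m → Vec Bool ⌈log₂ n ⌉) λ code →
               ∀ x y → part x ≡ part y → code x ≡ code y → x ≡ y
block-code {m} part {n} bounded = code , code-injective
  where
  rank< : ∀ x → rank part x < 2 ^ ⌈log₂ n ⌉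
  rank< x = <-≤-trans (rank<∣block∣ part x) (≤-trans (bounded (part x)) (n≤2^⌈log₂n⌉ n))
  code : Fin m → Vec Bool ⌈log₂ n ⌉
  code x = toBits ⌈log₂ n ⌉ (fromℕ< (rank< x))
  code-injective : ∀ x y → part x ≡ part y → code x ≡ code y → x ≡ y
  code-injective x y same eq = rank-injective part x y same
    (fromℕ<-injective _ _ (rank< x) (rank< y) (toBits-injective ⌈log₂ n ⌉ eq))

∉-if-false : ∀ {m} (S : Subset m) {x} → lookup S x ≡ false → x ∉ S
∉-if-false S Sx≡false x∈S with () ← trans (sym ([]=⇒lookup x∈S)) Sx≡false

separates-if-differ : ∀ {m} (S : Subset m) {x y} → lookup S x ≢ lookup S y → Separates S x y
separates-if-differ S {x} {y} Sx≢Sy with lookup S x in Sx | lookup S y in Sy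
... | true  | true  = ⊥-elim (Sx≢Sy refl)
... | false | false = ⊥-elim (Sx≢Sy refl)
... | true  | false = inj₁ (lookup⇒[]= x S Sx , ∉-if-false S Sy)
... | false | true  = inj₂ (lookup⇒[]= y S Sy , ∉-if-false S Sx)

not-separates : ∀ {m} (S : Subset m) {x y} → lookup S x ≡ lookup S y → ¬ Separates S x y
not-separates S {x} {y} Sx≡Sy (inj₁ (x∈S , y∉S)) = y∉S (lookup⇒[]= y S (trans (sym Sx≡Sy) ([]=⇒lookup x∈S)))
not-separates S {x} {y} Sx≡Sy (inj₂ (y∈S , x∉S)) = x∉S (lookup⇒[]= x S (trans Sx≡Sy ([]=⇒lookup y∈S)))

module LinearFamily {m t : ℕ} (code : Fin m → Vec Bool t) where

  φ : Vec Bool t → Subset m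
  φ α = tabulate (λ x → α · code x)

  lookup-translate : ∀ A α x → lookup (A ⊕ φ α) x ≡ lookup A x xor (α · code x)
  lookup-translate A α x =
    trans (lookup-zipWith _xor_ x A (φ α)) (cong (lookup A x xor_) (lookup∘tabulate _ x))

  lookup-direction : ∀ A α₀ β x →
                     lookup (A ⊕ φ (α₀ ⊕ β)) x ≡ lookup (A ⊕ φ α₀) x xor (β · code x)
  lookup-direction A α₀ β x = begin
    lookup (A ⊕ φ (α₀ ⊕ β)) x                    ≡⟨ lookup-translate A (α₀ ⊕ β) x ⟩
    lookup A x xor ((α₀ ⊕ β) · code x)           ≡⟨ cong (lookup A x xor_) (·-linearˡ α₀ β (code x)) ⟩
    lookup A x xor ((α₀ · code x) xor (β · code x)) ≡⟨ xor-assoc (lookup A x) _ _ ⟨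
    (lookup A x xor (α₀ · code x)) xor (β · code x) ≡⟨ cong (_xor (β · code x)) (lookup-translate A α₀ x) ⟨
    lookup (A ⊕ φ α₀) x xor (β · code x)         ∎
    where open ≡-Reasoning

  translates : Subset m → Vec Bool t → List (Vec Bool t) → List (Subset m)
  translates A α₀ βs = A ⊕ φ α₀ ∷ map (λ β → A ⊕ φ (α₀ ⊕ β)) βs

  translates-separate : ∀ {k} (part : Fin m → Fin k) →
                        (∀ x y → part x ≡ part y → code x ≡ code y → x ≡ y) →
                        ∀ A α₀ βs → Distinguishing βs → SeparatesBlocks part (translates A α₀ βs)
  translates-separate part code-injective A α₀ βs distinguishing x y same-block x≢y
    with lookup (A ⊕ φ α₀) x Bool.≟ lookup (A ⊕ φ α₀) y
  ... | no  differ = here (separates-if-differ (A ⊕ φ α₀) differ)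
  ... | yes agree  = there (Any.map⁺ (Any.map by-direction
                      (distinguishing (code x) (code y) (x≢y ∘ code-injective x y same-block))))
    where
    by-direction : ∀ {β} → β · code x ≢ β · code y → Separates (A ⊕ φ (α₀ ⊕ β)) x y
    by-direction {β} β-differs = separates-if-differ (A ⊕ φ (α₀ ⊕ β)) λ eq → β-differs
      (xor-cancelˡ (lookup (A ⊕ φ α₀) x) (begin
        lookup (A ⊕ φ α₀) x xor (β · code x) ≡⟨ lookup-direction A α₀ β x ⟨
        lookup (A ⊕ φ (α₀ ⊕ β)) x            ≡⟨ eq ⟩
        lookup (A ⊕ φ (α₀ ⊕ β)) y            ≡⟨ lookup-direction A α₀ β y ⟩
        lookup (A ⊕ φ α₀) y xor (β · code y) ≡⟨ cong (_xor (β · code y)) agree ⟨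
        lookup (A ⊕ φ α₀) x xor (β · code y) ∎))
      where open ≡-Reasoning

  -- Averaging over all translates A: since F covers more than half of the
  -- cube, some A ⊕ φ(𝔹^t) meets F in more than half of its 2^t points.
  dense-translate : (F : List (Subset m)) → 2 ^ m < 2 * length F →
                    ∃[ A ] 2 ^ t < 2 * sumCube t (λ α → occ (A ⊕ φ α) F)
  dense-translate F large = sumCube-average m (λ A → 2 * sumCube t (λ α → occ (A ⊕ φ α) F)) (2 ^ t)
    (subst (2 ^ t * 2 ^ m <_) (sym total) (begin-strict
      2 ^ t * 2 ^ m       <⟨ *-monoʳ-< (2 ^ t) {{m^n≢0 2 t}} large ⟩
      2 ^ t * (2 * L)     ≡⟨ *-comm (2 ^ t) (2 * L) ⟩
      2 * L * 2 ^ t       ≡⟨ *-assoc 2 L (2 ^ t) ⟩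
      2 * (L * 2 ^ t)     ∎))
    where
    open ≤-Reasoning
    L : ℕ
    L = length F
    total : sumCube m (λ A → 2 * sumCube t (λ α → occ (A ⊕ φ α) F)) ≡ 2 * (L * 2 ^ t)
    total = begin-equality
      sumCube m (λ A → 2 * sumCube t (λ α → occ (A ⊕ φ α) F)) ≡⟨ sumCube-*ˡ m 2 _ ⟩
      2 * sumCube m (λ A → sumCube t (λ α → occ (A ⊕ φ α) F)) ≡⟨ cong (2 *_) (sumCube-swap m t _) ⟩
      2 * sumCube t (λ α → sumCube m (λ A → occ (A ⊕ φ α) F)) ≡⟨ cong (2 *_) (sumCube-cong t (λ α →
                                                                    sumCube-translate m (λ S → occ S F) (φ α))) ⟩
      2 * sumCube t (λ α → sumCube m (λ S → occ S F))         ≡⟨ cong (2 *_) (sumCube-cong t (λ α → sumCube-occ m F)) ⟩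
      2 * sumCube t (λ α → L)                                 ≡⟨ cong (2 *_) (sumCube-const t L) ⟩
      2 * (L * 2 ^ t)                                         ∎

separating-subfamily :
  (n : ℕ) → 1 ≤ n → (k m : ℕ) → (part : Fin m → Fin k) →
  BlocksBounded part n → (F : List (Subset m)) → LargeFamily m F →
  ∃[ G ] (SubFamily G F × length G ≤ ⌈log₂ n ⌉ + 1 × SeparatesBlocks part G)
separating-subfamily n _ k m part bounded F (unique , large) =
  translates A base dirs , members , ≤-reflexive size ,
  translates-separate part code-injective A base dirs distinguishing
  where
  t : ℕ
  t = ⌈log₂ n ⌉
  code : Fin m → Vec Bool t
  code = proj₁ (block-code part bounded)
  code-injective : ∀ x y → part x ≡ part y → code x ≡ code y → x ≡ y
  code-injective = proj₂ (block-code part bounded)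
  open LinearFamily code
  translate : ∃[ A ] 2 ^ t < 2 * sumCube t (λ α → occ (A ⊕ φ α) F)
  translate = dense-translate F large
  A : Subset m
  A = proj₁ translate
  open Frame (frame t (λ α → occ (A ⊕ φ α) F) (λ α → occ-unique (A ⊕ φ α) F unique) (proj₂ translate))
  members : SubFamily (translates A base dirs) F
  members = occ-member _ F base∈D ∷ All.map⁺ (All.map (occ-member _ F) dirs∈D)
  size : length (translates A base dirs) ≡ t + 1
  size = trans (cong suc (trans (length-map _ dirs) #dirs)) (+-comm 1 t)

2^<n : ∀ n s → s < ⌈log₂ n ⌉ → 2 ^ s < n
2^<n n s s<L with 2 ^ s <? n
... | yes 2^s<n = 2^s<n
... | no  2^s≮n = ⊥-elim (<⇒≱ s<L (≤-trans (⌈log₂⌉-mono-≤ (≮⇒≥ 2^s≮n)) (≤-reflexive (⌈log₂2^n⌉≡n s))))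

fromBit : Bool → Fin 2
fromBit false = zero
fromBit true  = suc zero

fromBit-injective : ∀ {a b} → fromBit a ≡ fromBit b → a ≡ b
fromBit-injective {false} {false} _ = refl
fromBit-injective {true}  {true}  _ = refl

signature : ∀ {m} (G : List (Subset m)) → Fin m → Fin (2 ^ length G)
signature []      x = zero
signature (S ∷ G) x = combine (fromBit (lookup S x)) (signature G x)

same-signature : ∀ {m} (G : List (Subset m)) {x y} →
                 signature G x ≡ signature G y → ¬ Any (λ S → Separates S x y) G
same-signature (S ∷ G) eq (here sep) =
  not-separates S (fromBit-injective (combine-injectiveˡ _ _ _ _ eq)) sep
same-signature (S ∷ G) {x} {y} eq (there sep) =
  same-signature G (combine-injectiveʳ (fromBit (lookup S x)) _ (fromBit (lookup S y)) _ eq) sep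

unseparated-pair : ∀ {m n} (G : List (Subset m)) (e : Fin n → Fin m) → 2 ^ length G < n →
                   ∃₂ λ a b → a ≢ b × ¬ Any (λ S → Separates S (e a) (e b)) G
unseparated-pair G e small =
  let a , b , a<b , same = pigeonhole small (signature G ∘ e)
  in a , b , <⇒≢ᶠ a<b , same-signature G same

more-than-half : ∀ {X Y Z} → X + Y ≡ Z → 2 * Y < Z → Z < 2 * X
more-than-half {X} {Y} {Z} X+Y≡Z 2Y<Z = +-cancelˡ-< Z Z (2 * X) (begin-strict
  Z + Z           ≡⟨ cong (Z +_) (+-identityʳ Z) ⟨
  2 * Z           ≡⟨ cong (2 *_) X+Y≡Z ⟨
  2 * (X + Y)     ≡⟨ *-distribˡ-+ 2 X Y ⟩
  2 * X + 2 * Y   <⟨ +-monoʳ-< (2 * X) 2Y<Z ⟩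
  2 * X + Z       ≡⟨ +-comm (2 * X) Z ⟩
  Z + 2 * X       ∎)
  where open ≤-Reasoning

take-drop-++ : ∀ {a r} (u : Vec Bool a) (v : Vec Bool r) → take a (u ++ v) ≡ u × drop a (u ++ v) ≡ v
take-drop-++ {a} u v = ++-injective (take a (u ++ v)) u (take++drop≡id a (u ++ v))

sumCube-product : ∀ a r (f : Vec Bool a → ℕ) (g : Vec Bool r → ℕ) →
                  sumCube (a + r) (λ S → f (take a S) * g (drop a S)) ≡ sumCube a f * sumCube r g
sumCube-product a r f g = begin
  sumCube (a + r) (λ S → f (take a S) * g (drop a S))
    ≡⟨ sumCube-++ a r _ ⟩
  sumCube a (λ u → sumCube r (λ v → f (take a (u ++ v)) * g (drop a (u ++ v))))
    ≡⟨ sumCube-cong a (λ u → sumCube-cong r (λ v →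
         cong₂ (λ u′ v′ → f u′ * g v′) (proj₁ (take-drop-++ u v)) (proj₂ (take-drop-++ u v)))) ⟩
  sumCube a (λ u → sumCube r (λ v → f u * g v))
    ≡⟨ sumCube-cong a (λ u → trans (sumCube-*ˡ r (f u) g) (*-comm (f u) _)) ⟩
  sumCube a (λ u → sumCube r g * f u)
    ≡⟨ sumCube-*ˡ a (sumCube r g) f ⟩
  sumCube r g * sumCube a f
    ≡⟨ *-comm _ (sumCube a f) ⟩
  sumCube a f * sumCube r g
    ∎
  where open ≡-Reasoning

sumCube-complement : ∀ m (p : Vec Bool m → Bool) →
                     sumCube m (𝟙 ∘ p) + sumCube m (𝟙 ∘ not ∘ p) ≡ 2 ^ m
sumCube-complement m p = begin
  sumCube m (𝟙 ∘ p) + sumCube m (𝟙 ∘ not ∘ p) ≡⟨ sumCube-+ m (𝟙 ∘ p) (𝟙 ∘ not ∘ p) ⟨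
  sumCube m (λ v → 𝟙 (p v) + 𝟙 (not (p v)))   ≡⟨ sumCube-cong m (either ∘ p) ⟩
  sumCube m (λ _ → 1)                         ≡⟨ sumCube-const m 1 ⟩
  1 * 2 ^ m                                   ≡⟨ *-identityˡ (2 ^ m) ⟩
  2 ^ m                                       ∎
  where
  open ≡-Reasoning
  either : ∀ b → 𝟙 b + 𝟙 (not b) ≡ 1
  either true  = refl
  either false = refl

constant? : ∀ {a} → Vec Bool a → Bool
constant? []      = true
constant? (b ∷ u) = does (u ≟ᵛ replicate _ b)

constant?-sound : ∀ {a} (u : Vec Bool a) → T (constant? u) → ∀ x y → lookup u x ≡ lookup u y
constant?-sound (b ∷ u) const x y with u ≟ᵛ replicate _ b
... | yes refl = trans (lookup-const x) (sym (lookup-const y))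
  where
  lookup-const : ∀ x → lookup (b ∷ replicate _ b) x ≡ b
  lookup-const zero    = refl
  lookup-const (suc x) = lookup-replicate x b

sumCube-constant : ∀ a → sumCube (suc a) (𝟙 ∘ constant?) ≡ 2
sumCube-constant a = cong₂ _+_ (sumCube-point a (replicate a true)) (sumCube-point a (replicate a false))

𝟙-not-∨ : ∀ x y → 𝟙 (not (x ∨ y)) ≡ 𝟙 (not x) * 𝟙 (not y)
𝟙-not-∨ true  y     = refl
𝟙-not-∨ false true  = refl
𝟙-not-∨ false false = refl

sumCube-nonconstant : ∀ a → sumCube (suc a) (𝟙 ∘ not ∘ constant?) + 2 ≡ 2 ^ suc a
sumCube-nonconstant a = trans (+-comm _ 2)
  (trans (cong (_+ sumCube (suc a) (𝟙 ∘ not ∘ constant?)) (sym (sumCube-constant a)))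
         (sumCube-complement (suc a) constant?))

allVecs : ∀ m → List (Vec Bool m)
allVecs zero    = [] ∷ []
allVecs (suc m) = map (true ∷_) (allVecs m) List.++ map (false ∷_) (allVecs m)

allVecs-unique : ∀ m → Unique (allVecs m)
allVecs-unique zero    = All.[] ∷ []
allVecs-unique (suc m) =
  Unique.++⁺ (Unique.map⁺ ∷-injectiveʳ (allVecs-unique m)) (Unique.map⁺ ∷-injectiveʳ (allVecs-unique m)) disjoint
  where
  disjoint : ∀ {v} → ¬ (v ∈ map (true ∷_) (allVecs m) × v ∈ map (false ∷_) (allVecs m))
  disjoint (inT , inF) with ∈-map⁻ (true ∷_) inT | ∈-map⁻ (false ∷_) inF
  ... | _ , _ , refl | _ , _ , ()

sum-allVecs : ∀ m (h : Vec Bool m → ℕ) → sum (map h (allVecs m)) ≡ sumCube m h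
sum-allVecs zero    h = +-identityʳ (h [])
sum-allVecs (suc m) h = begin
  sum (map h (map (true ∷_) all List.++ map (false ∷_) all))
    ≡⟨ cong sum (map-++ h (map (true ∷_) all) _) ⟩
  sum (map h (map (true ∷_) all) List.++ map h (map (false ∷_) all))
    ≡⟨ sum-++ (map h (map (true ∷_) all)) _ ⟩
  sum (map h (map (true ∷_) all)) + sum (map h (map (false ∷_) all))
    ≡⟨ cong₂ (λ xs ys → sum xs + sum ys) (map-∘ all) (map-∘ all) ⟨
  sum (map (h ∘ (true ∷_)) all) + sum (map (h ∘ (false ∷_)) all)
    ≡⟨ cong₂ _+_ (sum-allVecs m _) (sum-allVecs m _) ⟩
  sumCube (suc m) h
    ∎
  where
  open ≡-Reasoning
  all : List (Vec Bool m)
  all = allVecs m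

length-filterᵇ : ∀ {A : Set} (p : A → Bool) xs → length (filterᵇ p xs) ≡ sum (map (𝟙 ∘ p) xs)
length-filterᵇ p []       = refl
length-filterᵇ p (x ∷ xs) with p x
... | true  = cong suc (length-filterᵇ p xs)
... | false = length-filterᵇ p xs

vectorsWhere : ∀ {m} → (Vec Bool m → Bool) → List (Vec Bool m)
vectorsWhere p = filterᵇ p (allVecs _)

vectorsWhere-unique : ∀ {m} (p : Vec Bool m → Bool) → Unique (vectorsWhere p)
vectorsWhere-unique p = Unique.filter⁺ (T? ∘ p) (allVecs-unique _)

vectorsWhere-sound : ∀ {m} (p : Vec Bool m → Bool) {S} → S ∈ vectorsWhere p → T (p S)
vectorsWhere-sound p S∈ = proj₂ (∈-filter⁻ (T? ∘ p) {xs = allVecs _} S∈)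

length-vectorsWhere : ∀ m (p : Vec Bool m → Bool) → length (vectorsWhere p) ≡ sumCube m (𝟙 ∘ p)
length-vectorsWhere m p = trans (length-filterᵇ p (allVecs m)) (sum-allVecs m (𝟙 ∘ p))

∣tabulate∣-+ : ∀ a {r} (f : Fin (a + r) → Bool) →
               ∣ tabulate f ∣ ≡ ∣ tabulate (f ∘ (_↑ˡ r)) ∣ + ∣ tabulate (f ∘ (a ↑ʳ_)) ∣
∣tabulate∣-+ zero    f = refl
∣tabulate∣-+ (suc a) f with f zero
... | true  = cong suc (∣tabulate∣-+ a (f ∘ suc))
... | false = ∣tabulate∣-+ a (f ∘ suc)

∣tabulate-inside∣ : ∀ n → ∣ tabulate {n = n} (λ _ → inside) ∣ ≡ n
∣tabulate-inside∣ zero    = refl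
∣tabulate-inside∣ (suc n) = cong suc (∣tabulate-inside∣ n)

∣tabulate-outside∣ : ∀ n → ∣ tabulate {n = n} (λ _ → outside) ∣ ≡ 0
∣tabulate-outside∣ zero    = refl
∣tabulate-outside∣ (suc n) = ∣tabulate-outside∣ n

module Blocks (n : ℕ) where

  size : ℕ → ℕ
  size zero    = 0
  size (suc j) = n + size j

  blockOf : ∀ j → Fin (size j) → Fin j
  blockOf (suc j) x = [ (λ _ → zero) , (λ y → suc (blockOf j y)) ]′ (Fin.splitAt n x)

  member : ∀ j → Fin j → Fin n → Fin (size j)
  member (suc j) zero    a = a ↑ˡ size j
  member (suc j) (suc i) a = n ↑ʳ member j i a

  blockOf-first : ∀ j a → blockOf (suc j) (a ↑ˡ size j) ≡ zero
  blockOf-first j a rewrite splitAt-↑ˡ n a (size j) = refl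

  blockOf-rest : ∀ j x → blockOf (suc j) (n ↑ʳ x) ≡ suc (blockOf j x)
  blockOf-rest j x rewrite splitAt-↑ʳ n (size j) x = refl

  blockOf-member : ∀ j i a → blockOf j (member j i a) ≡ i
  blockOf-member (suc j) zero    a = blockOf-first j a
  blockOf-member (suc j) (suc i) a = trans (blockOf-rest j _) (cong suc (blockOf-member j i a))

  member-injective : ∀ j i {a b} → member j i a ≡ member j i b → a ≡ b
  member-injective (suc j) zero    eq = ↑ˡ-injective (size j) _ _ eq
  member-injective (suc j) (suc i) eq = member-injective j i (↑ʳ-injective n _ _ eq)

  inBlock : ∀ {j} → Fin j → Fin j → Bool
  inBlock i b = if does (b Fin.≟ i) then inside else outside

  ∣block∣-split : ∀ j i → ∣ block (blockOf (suc j)) i ∣ ≡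
                  ∣ tabulate {n = n} (λ _ → inBlock i zero) ∣
                    + ∣ tabulate (λ x → inBlock i (suc (blockOf j x))) ∣
  ∣block∣-split j i = trans (∣tabulate∣-+ n (inBlock i ∘ blockOf (suc j)))
    (cong₂ _+_ (cong ∣_∣ (tabulate-cong (cong (inBlock i) ∘ blockOf-first j)))
               (cong ∣_∣ (tabulate-cong (cong (inBlock i) ∘ blockOf-rest j))))

  ∣block∣≡n : ∀ j i → ∣ block (blockOf j) i ∣ ≡ n
  ∣block∣≡n (suc j) zero    = trans (∣block∣-split j zero)
    (trans (cong₂ _+_ (∣tabulate-inside∣ n) (∣tabulate-outside∣ (size j))) (+-identityʳ n))
  ∣block∣≡n (suc j) (suc i) = trans (∣block∣-split j (suc i))
    (cong₂ _+_ (∣tabulate-outside∣ n) (∣block∣≡n j i))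

  same-block : ∀ {j} (i : Fin j) a b → blockOf j (member j i a) ≡ blockOf j (member j i b)
  same-block {j} i a b = trans (blockOf-member j i a) (sym (blockOf-member j i b))

  ConstantOn : ∀ {j} → Fin j → Subset (size j) → Set
  ConstantOn {j} i S = ∀ a b → lookup S (member j i a) ≡ lookup S (member j i b)

  hasConstantBlock : ∀ j → Subset (size j) → Bool
  hasConstantBlock zero    _ = false
  hasConstantBlock (suc j) S = constant? (take n S) ∨ hasConstantBlock j (drop n S)

  lookup-take : ∀ {r} (S : Vec Bool (n + r)) a → lookup S (a ↑ˡ r) ≡ lookup (take n S) a
  lookup-take S a = trans (cong (λ V → lookup V (a ↑ˡ _)) (sym (take++drop≡id n S))) (lookup-++ˡ (take n S) (drop n S) a)

  lookup-drop : ∀ {r} (S : Vec Bool (n + r)) x → lookup S (n ↑ʳ x) ≡ lookup (drop n S) x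
  lookup-drop S x = trans (cong (λ V → lookup V (n ↑ʳ x)) (sym (take++drop≡id n S))) (lookup-++ʳ (take n S) _ x)

  hasConstantBlock-sound : ∀ j S → T (hasConstantBlock j S) → ∃ λ i → ConstantOn {j} i S
  hasConstantBlock-sound (suc j) S has with Equivalence.to T-∨ has
  ... | inj₁ first = zero , λ a b →
    trans (lookup-take S a) (trans (constant?-sound (take n S) first a b) (sym (lookup-take S b)))
  ... | inj₂ later = let i , const = hasConstantBlock-sound j (drop n S) later in suc i , λ a b →
    trans (lookup-drop S _) (trans (const a b) (sym (lookup-drop S _)))

  nonconstant : ℕ
  nonconstant = sumCube n (𝟙 ∘ not ∘ constant?)

  -- Subsets constant on no block: each block independently takes a non-constant pattern.
  sumCube-noConstantBlock : ∀ j → sumCube (size j) (𝟙 ∘ not ∘ hasConstantBlock j) ≡ nonconstant ^ j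
  sumCube-noConstantBlock zero    = refl
  sumCube-noConstantBlock (suc j) = begin
    sumCube (n + size j) (𝟙 ∘ not ∘ hasConstantBlock (suc j))
      ≡⟨ sumCube-cong (n + size j) (λ S → 𝟙-not-∨ (constant? (take n S)) _) ⟩
    sumCube (n + size j) (λ S → 𝟙 (not (constant? (take n S))) * 𝟙 (not (hasConstantBlock j (drop n S))))
      ≡⟨ sumCube-product n (size j) _ _ ⟩
    nonconstant * sumCube (size j) (𝟙 ∘ not ∘ hasConstantBlock j)
      ≡⟨ cong (nonconstant *_) (sumCube-noConstantBlock j) ⟩
    nonconstant ^ suc j
      ∎
    where open ≡-Reasoning

  family : ∀ j → List (Subset (size j))
  family j = vectorsWhere (hasConstantBlock j)

  family-large : ∀ j → nonconstant + 2 ≡ 2 ^ n → 2 * nonconstant ^ j < (nonconstant + 2) ^ j →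
                 LargeFamily (size j) (family j)
  family-large j c+2≡2^n few = vectorsWhere-unique (hasConstantBlock j) ,
    more-than-half {length (family j)} {nonconstant ^ j} {2 ^ size j}
    (trans (cong (_+ nonconstant ^ j) (length-vectorsWhere (size j) (hasConstantBlock j)))
    (trans (cong (sumCube (size j) (𝟙 ∘ hasConstantBlock j) +_) (sym (sumCube-noConstantBlock j)))
           (sumCube-complement (size j) (hasConstantBlock j))))
    (subst (2 * nonconstant ^ j <_) (sym (2^size j)) few)
    where
    2^size : ∀ j → 2 ^ size j ≡ (nonconstant + 2) ^ j
    2^size zero    = refl
    2^size (suc j) = trans (^-distribˡ-+-* 2 n (size j)) (cong₂ _*_ (sym c+2≡2^n) (2^size j))

  -- Fewer than ⌈log₂ n⌉ + 1 members of the family never separate all blocks: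
  -- the first member is constant on some block i, and the remaining ones,
  -- fewer than log₂ n many, leave two points of block i unseparated.
  no-small-separator : ∀ j → Fin j → 2 ≤ n → (G : List (Subset (size j))) → SubFamily G (family j) →
                       length G ≤ ⌈log₂ n ⌉ → ¬ SeparatesBlocks (blockOf j) G
  no-small-separator j i₀ 2≤n [] _ _ separates
    with unseparated-pair [] (member j i₀) 2≤n
  ... | a , b , a≢b , none = none (separates _ _ (same-block i₀ a b) (a≢b ∘ member-injective j i₀))
  no-small-separator j i₀ 2≤n (S ∷ G) (S∈family ∷ _) short separates
    with hasConstantBlock-sound j S (vectorsWhere-sound (hasConstantBlock j) S∈family)
  ... | i , constant
    with unseparated-pair G (member j i) (2^<n n (length G) short)
  ... | a , b , a≢b , none
    with separates _ _ (same-block i a b) (a≢b ∘ member-injective j i)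
  ... | here  S-separates = not-separates S (constant a b) S-separates
  ... | there G-separates = none G-separates

bernoulli : ∀ a k → a ^ k * (a + 2 * k) ≤ a * (a + 2) ^ k
bernoulli a zero    = ≤-reflexive (base a)
  where
  base : ∀ a → 1 * (a + 2 * 0) ≡ a * 1
  base = solve-∀
bernoulli a (suc k) = begin
  a * Y * (a + 2 * suc k)                      ≡⟨ expand a Y k ⟩
  a * (Y * (a + 2 * k)) + 2 * (a * Y)          ≤⟨ +-monoʳ-≤ (a * (Y * (a + 2 * k))) (*-monoʳ-≤ 2 aY≤) ⟩
  a * (Y * (a + 2 * k)) + 2 * (Y * (a + 2 * k)) ≡⟨ collect a (Y * (a + 2 * k)) ⟩
  (a + 2) * (Y * (a + 2 * k))                  ≤⟨ *-monoʳ-≤ (a + 2) (bernoulli a k) ⟩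
  (a + 2) * (a * (a + 2) ^ k)                  ≡⟨ swap a ((a + 2) ^ k) ⟩
  a * (a + 2) ^ suc k                          ∎
  where
  open ≤-Reasoning
  Y : ℕ
  Y = a ^ k
  aY≤ : a * Y ≤ Y * (a + 2 * k)
  aY≤ = ≤-trans (≤-reflexive (*-comm a Y)) (*-monoʳ-≤ Y (m≤m+n a (2 * k)))
  expand : ∀ a Y k → a * Y * (a + 2 * suc k) ≡ a * (Y * (a + 2 * k)) + 2 * (a * Y)
  expand = solve-∀
  collect : ∀ a W → a * W + 2 * W ≡ (a + 2) * W
  collect = solve-∀
  swap : ∀ a W → (a + 2) * (a * W) ≡ a * ((a + 2) * W)
  swap = solve-∀

-- Taking k = a ≥ 1:  2 a^a < 3 a^a ≤ (a + 2)^a.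
2a^a<[a+2]^a : ∀ a → 1 ≤ a → 2 * a ^ a < (a + 2) ^ a
2a^a<[a+2]^a a@(suc _) _ = begin-strict
  2 * a ^ a         <⟨ m<n+m (2 * a ^ a) (m^n>0 a a) ⟩
  a ^ a + 2 * a ^ a ≡⟨ three (a ^ a) ⟩
  3 * a ^ a         ≤⟨ *-cancelˡ-≤ a (≤-trans (≤-reflexive (reorder a (a ^ a))) (bernoulli a a)) ⟩
  (a + 2) ^ a       ∎
  where
  open ≤-Reasoning
  three : ∀ Y → Y + 2 * Y ≡ 3 * Y
  three = solve-∀
  reorder : ∀ a Y → a * (3 * Y) ≡ Y * (a + 2 * a)
  reorder = solve-∀

tightness : (n : ℕ) → 2 ≤ n →
  ∃[ k ] ∃[ m ] Σ (Fin m → Fin k) λ part → BlocksBounded part n ×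
    Σ (List (Subset m)) λ F → LargeFamily m F ×
      ((G : List (Subset m)) → SubFamily G F → length G ≤ ⌈log₂ n ⌉ → ¬ SeparatesBlocks part G)
tightness (suc zero)      (s≤s ())
tightness n@(suc (suc a)) 2≤n =
  c , size c , blockOf c , (λ i → ≤-reflexive (∣block∣≡n c i)) ,
  family c , family-large c c+2≡2^n (2a^a<[a+2]^a c 1≤c) ,
  no-small-separator c (fromℕ< 1≤c) 2≤n
  where
  open Blocks n
  c : ℕ
  c = nonconstant
  c+2≡2^n : c + 2 ≡ 2 ^ n
  c+2≡2^n = sumCube-nonconstant (suc a)
  1≤c : 1 ≤ c
  1≤c = +-cancelʳ-≤ 2 1 c (≤-trans (n≤1+n 3) (subst (4 ≤_) (sym c+2≡2^n) (^-monoʳ-≤ 2 (m≤m+n 2 a))))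

theorem2 :
    ((n : ℕ) → 1 ≤ n → (k m : ℕ) → (part : Fin m → Fin k) →
      BlocksBounded part n → (F : List (Subset m)) → LargeFamily m F →
      ∃[ G ] (SubFamily G F × length G ≤ ⌈log₂ n ⌉ + 1 × SeparatesBlocks part G))
    ×
    ((n : ℕ) → 2 ≤ n →
      ∃[ k ] ∃[ m ] Σ (Fin m → Fin k) λ part → BlocksBounded part n ×
        Σ (List (Subset m)) λ F → LargeFamily m F ×
          ((G : List (Subset m)) → SubFamily G F → length G ≤ ⌈log₂ n ⌉ →
            ¬ SeparatesBlocks part G))
theorem2 = separating-subfamily , tightness
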